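{- Let $n\ge 3$ and let $a,b$ be integers such that $f,r^af,r^bf$ are three distinct elements of $D_n$ and $S=\{f,r^af,r^bf\}$ generates $D_n$. Then $\lambda_2(D_n,S)=2$.
   Context: The dihedral group $D_n$ is the group of order $2n$ with presentation $\langle r,f\mid r^n=f^2=1,\ rf=fr^{ -1}\rangle$. For a generating set $S$ of a finite group $G$ and $g\in G$, $l_S(g)$ is the minimal number of factors in an expression of $g$ as a product of elements of $S$ ($l_S(1)=0$). Define $\lambda_2(G,S)=\max_{g\in G,\,s,s'\in S} l_S(gss'g^{ -1})$. -}

module Defs where

open import Data.Nat using (ℕ; zero; suc; _≤_; _<_; _∸_; NonZero)
import Data.Nat as ℕ
open import Data.Nat.DivMod using (_mod_)
open import Data.Integer using (ℤ)
open import Data.Integer.DivMod using (_%ℕ_)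
open import Data.Fin using (Fin; toℕ)
open import Data.Bool using (Bool; true; false; _xor_)
open import Data.Product using (_×_; _,_; ∃; ∃-syntax; Σ-syntax)
open import Data.Sum using (_⊎_)
open import Data.List using (List; []; _∷_; length; map)
open import Data.List.Membership.Propositional using (_∈_)
open import Relation.Nullary using (¬_)
open import Relation.Binary.PropositionalEquality using (_≡_)

-- The dihedral group D_n of order 2n, for n ≥ 1 (NonZero n).
-- The element (i , e) stands for r^i f^e  (i ∈ Z/n, e ∈ {0,1}; false = 0, true = 1).
D : ℕ → Set
D n = Fin n × Bool

module Dihedral (n : ℕ) .{{_ : NonZero n}} where

  one : D n
  one = (0 mod n , false)

  -- r^i f^e · r^j f^e' = r^(i + (-1)^e j) f^(e+e')   (using f r^j = r^(-j) f)
  _·_ : D n → D n → D n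
  (i , false) · (j , e') = ((toℕ i ℕ.+ toℕ j) mod n , e')
  (i , true)  · (j , e') = ((toℕ i ℕ.+ (n ∸ toℕ j)) mod n , true xor e')

  -- inverse: (r^i)⁻¹ = r^(-i), and reflections r^i f are involutions
  inv : D n → D n
  inv (i , false) = ((n ∸ toℕ i) mod n , false)
  inv (i , true)  = (i , true)

  f : D n
  f = (0 mod n , true)

  rpow : ℤ → D n
  rpow a = ((a %ℕ n) mod n , false)

  prod : List (D n) → D n
  prod []       = one
  prod (x ∷ xs) = x · prod xs

  ProductOfLength : List (D n) → D n → ℕ → Set
  ProductOfLength S g k = ∃[ w ] (length w ≡ k × (∀ {x} → x ∈ w → x ∈ S) × prod w ≡ g)

  Generates : List (D n) → Set
  Generates S = ∀ g → ∃[ w ] ((∀ {x} → x ∈ w → (x ∈ S ⊎ inv x ∈ S)) × prod w ≡ g)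

  WordLength : List (D n) → D n → ℕ → Set
  WordLength S g m = ProductOfLength S g m × (∀ k → k < m → ¬ ProductOfLength S g k)

  -- λ_2(D_n, S) = m : maximum over g ∈ D_n, s, s' ∈ S of l_S(g s s' g⁻¹) equals m
  Lambda2 : List (D n) → ℕ → Set
  Lambda2 S m =
    (∀ g s s' → s ∈ S → s' ∈ S → ∃[ k ] (k ≤ m × WordLength S (g · (s · (s' · inv g))) k))
    × (∃[ g ] ∃[ s ] ∃[ s' ] (s ∈ S × s' ∈ S × WordLength S (g · (s · (s' · inv g))) m))

module Submission where

-- Every element of S = {f, r^a f, r^b f} is a reflection.
-- For reflections s, s' and any g ∈ D_n, the conjugate g s s' g⁻¹ equals s s'
-- when g is a rotation and s' s when g is a reflection; in both cases it is a
-- product of two elements of S, so its length is at most 2.  A product of two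
-- reflections is a rotation, whereas products of exactly one element of S are
-- reflections; hence such a conjugate has length 0 (if it is 1) or exactly 2.
-- Finally f · r^a f ≠ 1 because f ≠ r^a f, so the value 2 is attained.

open import Defs
open import Data.Nat using (ℕ; zero; suc; NonZero; _≤_; _<_; z≤n; s≤s; _≥_; _∸_)
import Data.Nat as ℕ
import Data.Nat.Properties as ℕP
open import Data.Nat.Divisibility using (>⇒∤) renaming (_∣_ to _∣ℕ_)
open import Data.Nat.DivMod using (_mod_; m%n<n)
open import Data.Integer using (ℤ; +_; _+_; _-_; _*_; -_; _⊖_; ∣_∣)
import Data.Integer.Properties as ℤP
open import Data.Integer.DivMod using (a≡a%ℕn+[a/ℕn]*n)
open import Data.Integer.Divisibility.Signed using (_∣_; divides; ∣⇒∣ᵤ; ∣m∣n⇒∣m+n; ∣m⇒∣-m)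
open import Data.Integer.Tactic.RingSolver using (solve-∀)
open import Data.Fin using (Fin; toℕ)
open import Data.Fin.Properties using (toℕ<n; toℕ-injective; toℕ-fromℕ<) renaming (_≟_ to _≟ᶠ_)
open import Data.Bool using (true; false)
open import Data.Bool.Properties using () renaming (_≟_ to _≟ᵇ_)
open import Data.Product using (_,_; proj₁; proj₂; _×_; ∃-syntax)
open import Data.Product.Properties using (≡-dec)
open import Data.Sum using (_⊎_; inj₁; inj₂)
open import Data.List using (List; []; _∷_)
open import Data.List.Membership.Propositional using (_∈_)
open import Data.List.Relation.Unary.Any using (here; there)
open import Data.Empty using (⊥-elim)
open import Level using (0ℓ)
open import Relation.Nullary using (yes; no; ¬_)
open import Relation.Binary.Bundles using (Setoid)
open import Relation.Binary.PropositionalEquality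

module Congruence (n : ℕ) .{{_ : NonZero n}} where

  -- u ≡ₙ v : the integers u and v are congruent modulo n, i.e. n ∣ u - v.
  -- (A record, so that u and v can be inferred from a proof.)
  infix 4 _≡ₙ_
  record _≡ₙ_ (u v : ℤ) : Set where
    constructor congruent
    field n∣u-v : + n ∣ u - v

  ≡ₙ-offset : ∀ {u v} q → u ≡ v + q * + n → u ≡ₙ v
  ≡ₙ-offset {u} {v} q refl = congruent (divides q (difference v q (+ n)))
    where difference : ∀ v q m → (v + q * m) - v ≡ q * m
          difference = solve-∀

  ≡ₙ-reflexive : ∀ {u v} → u ≡ v → u ≡ₙ v
  ≡ₙ-reflexive {u} refl = ≡ₙ-offset (+ 0) (sym (ℤP.+-identityʳ u))

  private
    ∣-along : ∀ {w u v} → w ≡ u - v → + n ∣ w → u ≡ₙ v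
    ∣-along eq d = congruent (subst (+ n ∣_) eq d)

  ≡ₙ-sym : ∀ {u v} → u ≡ₙ v → v ≡ₙ u
  ≡ₙ-sym {u} {v} (congruent d) = ∣-along (swap u v) (∣m⇒∣-m d)
    where swap : ∀ u v → - (u - v) ≡ v - u
          swap = solve-∀

  ≡ₙ-trans : ∀ {u v w} → u ≡ₙ v → v ≡ₙ w → u ≡ₙ w
  ≡ₙ-trans {u} {v} {w} (congruent d) (congruent e) = ∣-along (telescope u v w) (∣m∣n⇒∣m+n d e)
    where telescope : ∀ u v w → (u - v) + (v - w) ≡ u - w
          telescope = solve-∀

  +-cong : ∀ {u v u' v'} → u ≡ₙ v → u' ≡ₙ v' → u + u' ≡ₙ v + v'
  +-cong {u} {v} {u'} {v'} (congruent d) (congruent e) = ∣-along (regroup u v u' v') (∣m∣n⇒∣m+n d e)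
    where regroup : ∀ u v u' v' → (u - v) + (u' - v') ≡ (u + u') - (v + v')
          regroup = solve-∀

  neg-cong : ∀ {u v} → u ≡ₙ v → - u ≡ₙ - v
  neg-cong {u} {v} (congruent d) = ∣-along (negate u v) (∣m⇒∣-m d)
    where negate : ∀ u v → - (u - v) ≡ - u - - v
          negate = solve-∀

  -- Rewriting one summand (the other, which cannot be inferred, is given).
  +-congˡ : ∀ u {v v'} → v ≡ₙ v' → u + v ≡ₙ u + v'
  +-congˡ u = +-cong (≡ₙ-reflexive {u} refl)

  +-congʳ : ∀ v {u u'} → u ≡ₙ u' → u + v ≡ₙ u' + v
  +-congʳ v d = +-cong d (≡ₙ-reflexive {v} refl)

  -‿congˡ : ∀ u {v v'} → v ≡ₙ v' → u - v ≡ₙ u - v'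
  -‿congˡ u d = +-congˡ u (neg-cong d)

  ≡ₙ-setoid : Setoid 0ℓ 0ℓ
  ≡ₙ-setoid = record
    { Carrier = ℤ
    ; _≈_ = _≡ₙ_
    ; isEquivalence = record { refl = ≡ₙ-reflexive refl ; sym = ≡ₙ-sym ; trans = ≡ₙ-trans }
    }

  ⟦_⟧ : Fin n → ℤ
  ⟦ i ⟧ = + toℕ i

  mod-≡ₙ : ∀ m → ⟦ m mod n ⟧ ≡ₙ + m
  mod-≡ₙ m = ≡ₙ-trans (≡ₙ-reflexive (cong +_ (toℕ-fromℕ< (m%n<n m n))))
                      (≡ₙ-sym (≡ₙ-offset (+ (m ℕ./ n)) (a≡a%ℕn+[a/ℕn]*n (+ m) n)))

  complement-≡ₙ : ∀ j → + (n ∸ toℕ j) ≡ₙ - ⟦ j ⟧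
  complement-≡ₙ j = ≡ₙ-offset (+ 1) (begin
      + (n ∸ toℕ j)        ≡⟨ ℤP.≤-⊖ (ℕP.<⇒≤ (toℕ<n j)) ⟨
      n ⊖ toℕ j            ≡⟨ ℤP.[+m]-[+n]≡m⊖n n (toℕ j) ⟨
      + n - ⟦ j ⟧          ≡⟨ rearrange (+ n) ⟦ j ⟧ ⟩
      - ⟦ j ⟧ + + 1 * + n  ∎)
    where open ≡-Reasoning
          rearrange : ∀ m j → m - j ≡ - j + + 1 * m
          rearrange = solve-∀

  private
    small-multiple≡0 : ∀ {d m} → d ∣ℕ m → m < d → m ≡ 0
    small-multiple≡0 {m = zero}  _   _   = refl
    small-multiple≡0 {m = suc _} d∣m m<d = ⊥-elim (>⇒∤ m<d d∣m)

  ≡ₙ⇒≡ : ∀ (i j : Fin n) → ⟦ i ⟧ ≡ₙ ⟦ j ⟧ → i ≡ j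
  ≡ₙ⇒≡ i j (congruent d) = toℕ-injective (ℤP.+-injective (ℤP.i-j≡0⇒i≡j ⟦ i ⟧ ⟦ j ⟧
                 (ℤP.∣i∣≡0⇒i≡0 (small-multiple≡0 (∣⇒∣ᵤ d) distance<n))))
    where
      distance<n : ∣ ⟦ i ⟧ - ⟦ j ⟧ ∣ < n
      distance<n = begin-strict
        ∣ ⟦ i ⟧ - ⟦ j ⟧ ∣     ≡⟨ cong ∣_∣ (ℤP.[+m]-[+n]≡m⊖n (toℕ i) (toℕ j)) ⟩
        ∣ toℕ i ⊖ toℕ j ∣     ≤⟨ ℤP.∣m⊝n∣≤m⊔n (toℕ i) (toℕ j) ⟩
        toℕ i ℕ.⊔ toℕ j       <⟨ ℕP.⊔-lub (toℕ<n i) (toℕ<n j) ⟩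
        n                     ∎
        where open ℕP.≤-Reasoning

module DihedralIndex (n : ℕ) .{{_ : NonZero n}} where
  open Dihedral n
  open Congruence n

  rotation : Fin n → D n
  rotation i = (i , false)

  IsReflection : D n → Set
  IsReflection z = proj₂ z ≡ true

  index : D n → ℤ
  index z = ⟦ proj₁ z ⟧

  index-injective : ∀ z w → index z ≡ₙ index w → proj₂ z ≡ proj₂ w → z ≡ w
  index-injective (i , e) (j , .e) d refl = cong (_, e) (≡ₙ⇒≡ i j d)

  index-rotation· : ∀ i w → index (rotation i · w) ≡ₙ ⟦ i ⟧ + index w
  index-rotation· i w = ≡ₙ-trans (mod-≡ₙ _) (≡ₙ-reflexive (ℤP.pos-+ (toℕ i) (toℕ (proj₁ w))))

  index-reflection· : ∀ i w → index ((i , true) · w) ≡ₙ ⟦ i ⟧ - index w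
  index-reflection· i w =
    ≡ₙ-trans (mod-≡ₙ _) (≡ₙ-trans (≡ₙ-reflexive (ℤP.pos-+ (toℕ i) _))
                                  (+-congˡ ⟦ i ⟧ (complement-≡ₙ (proj₁ w))))

  index-inv-rotation : ∀ i → index (inv (rotation i)) ≡ₙ - ⟦ i ⟧
  index-inv-rotation i = ≡ₙ-trans (mod-≡ₙ _) (complement-≡ₙ i)

  index-one : index one ≡ₙ + 0
  index-one = mod-≡ₙ 0

  index-reflection-pair : ∀ s s' w → IsReflection s → IsReflection s' →
                          index (s · (s' · w)) ≡ₙ (index s - index s') + index w
  index-reflection-pair (x , _) (y , _) w refl refl = begin
    index ((x , true) · ((y , true) · w))  ≈⟨ index-reflection· x ((y , true) · w) ⟩
    ⟦ x ⟧ - index ((y , true) · w)         ≈⟨ -‿congˡ ⟦ x ⟧ (index-reflection· y w) ⟩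
    ⟦ x ⟧ - (⟦ y ⟧ - index w)              ≡⟨ regroup ⟦ x ⟧ ⟦ y ⟧ (index w) ⟩
    (⟦ x ⟧ - ⟦ y ⟧) + index w              ∎
    where open import Relation.Binary.Reasoning.Setoid ≡ₙ-setoid
          regroup : ∀ x y w → x - (y - w) ≡ (x - y) + w
          regroup = solve-∀

  index-pair : ∀ s s' → IsReflection s → IsReflection s' →
               index (prod (s ∷ s' ∷ [])) ≡ₙ index s - index s'
  index-pair s s' rs rs' = begin
    index (prod (s ∷ s' ∷ []))        ≈⟨ index-reflection-pair s s' one rs rs' ⟩
    (index s - index s') + index one  ≈⟨ +-congˡ (index s - index s') index-one ⟩
    (index s - index s') + + 0        ≡⟨ ℤP.+-identityʳ (index s - index s') ⟩
    index s - index s'                ∎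
    where open import Relation.Binary.Reasoning.Setoid ≡ₙ-setoid

  conjugate-by-rotation : ∀ i s s' → IsReflection s → IsReflection s' →
    rotation i · (s · (s' · inv (rotation i))) ≡ prod (s ∷ s' ∷ [])
  conjugate-by-rotation i s s' rs rs' = index-injective _ _ index-eq (parity s s' rs rs')
    where
      open import Relation.Binary.Reasoning.Setoid ≡ₙ-setoid
      r⁻ⁱ = inv (rotation i)
      parity : ∀ s s' → IsReflection s → IsReflection s' →
               proj₂ (rotation i · (s · (s' · r⁻ⁱ))) ≡ proj₂ (prod (s ∷ s' ∷ []))
      parity (_ , _) (_ , _) refl refl = refl
      cancel : ∀ i d → i + (d + - i) ≡ d
      cancel = solve-∀
      index-eq : index (rotation i · (s · (s' · r⁻ⁱ))) ≡ₙ index (prod (s ∷ s' ∷ []))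
      index-eq = begin
        index (rotation i · (s · (s' · r⁻ⁱ)))   ≈⟨ index-rotation· i (s · (s' · r⁻ⁱ)) ⟩
        ⟦ i ⟧ + index (s · (s' · r⁻ⁱ))          ≈⟨ +-congˡ ⟦ i ⟧ (index-reflection-pair s s' r⁻ⁱ rs rs') ⟩
        ⟦ i ⟧ + ((index s - index s') + index r⁻ⁱ)
                                                ≈⟨ +-congˡ ⟦ i ⟧ (+-congˡ (index s - index s')
                                                                          (index-inv-rotation i)) ⟩
        ⟦ i ⟧ + ((index s - index s') + - ⟦ i ⟧) ≡⟨ cancel ⟦ i ⟧ (index s - index s') ⟩
        index s - index s'                      ≈⟨ index-pair s s' rs rs' ⟨
        index (prod (s ∷ s' ∷ []))              ∎

  conjugate-by-reflection : ∀ t s s' → IsReflection t → IsReflection s → IsReflection s' →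
    t · (s · (s' · inv t)) ≡ prod (s' ∷ s ∷ [])
  conjugate-by-reflection (i , _) s s' refl rs rs' =
    index-injective _ _ index-eq (parity s s' rs rs')
    where
      open import Relation.Binary.Reasoning.Setoid ≡ₙ-setoid
      t = (i , true)
      parity : ∀ s s' → IsReflection s → IsReflection s' →
               proj₂ (t · (s · (s' · inv t))) ≡ proj₂ (prod (s' ∷ s ∷ []))
      parity (_ , _) (_ , _) refl refl = refl
      reverse : ∀ i x y → i - ((x - y) + i) ≡ y - x
      reverse = solve-∀
      index-eq : index (t · (s · (s' · inv t))) ≡ₙ index (prod (s' ∷ s ∷ []))
      index-eq = begin
        index (t · (s · (s' · t)))              ≈⟨ index-reflection· i (s · (s' · t)) ⟩
        ⟦ i ⟧ - index (s · (s' · t))            ≈⟨ -‿congˡ ⟦ i ⟧ (index-reflection-pair s s' t rs rs') ⟩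
        ⟦ i ⟧ - ((index s - index s') + ⟦ i ⟧)  ≡⟨ reverse ⟦ i ⟧ (index s) (index s') ⟩
        index s' - index s                      ≈⟨ index-pair s' s rs' rs ⟨
        index (prod (s' ∷ s ∷ []))              ∎

  conjugate-pair : ∀ g s s' → IsReflection s → IsReflection s' →
    g · (s · (s' · inv g)) ≡ prod (s ∷ s' ∷ []) ⊎ g · (s · (s' · inv g)) ≡ prod (s' ∷ s ∷ [])
  conjugate-pair (i , false) s s' rs rs' = inj₁ (conjugate-by-rotation i s s' rs rs')
  conjugate-pair (i , true)  s s' rs rs' = inj₂ (conjugate-by-reflection (i , true) s s' refl rs rs')

  -- s s' = 1 forces s = s' (a reflection is its own inverse).
  trivial-pair⇒equal : ∀ s s' → IsReflection s → IsReflection s' →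
    prod (s ∷ s' ∷ []) ≡ one → s ≡ s'
  trivial-pair⇒equal s s' rs rs' trivial = index-injective s s' index-eq (trans rs (sym rs'))
    where
      open import Relation.Binary.Reasoning.Setoid ≡ₙ-setoid
      split : ∀ x y → x ≡ (x - y) + y
      split = solve-∀
      index-eq : index s ≡ₙ index s'
      index-eq = begin
        index s                                ≡⟨ split (index s) (index s') ⟩
        (index s - index s') + index s'        ≈⟨ +-congʳ (index s') (index-pair s s' rs rs') ⟨
        index (prod (s ∷ s' ∷ [])) + index s'  ≡⟨ cong (λ z → index z + index s') trivial ⟩
        index one + index s'                   ≈⟨ +-congʳ (index s') index-one ⟩
        + 0 + index s'                         ≡⟨ ℤP.+-identityˡ (index s') ⟩
        index s'                               ∎

module ReflectionWords (n : ℕ) .{{_ : NonZero n}} (S : List (D n)) where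
  open Dihedral n
  open DihedralIndex n

  AllReflections : Set
  AllReflections = ∀ {s} → s ∈ S → IsReflection s

  -- A rotation other than 1 is not a product of fewer than two elements of S:
  -- the empty product is 1 and a single factor is a reflection.
  no-short-word : AllReflections → ∀ z → proj₂ z ≡ false → z ≢ one →
                  ∀ k → k < 2 → ¬ ProductOfLength S z k
  no-short-word _     z _   z≢1 0 _ ([] , _ , _ , prod≡z) = z≢1 (sym prod≡z)
  no-short-word refls z rot _   1 _ ((t , _) ∷ [] , _ , t∈S , prod≡z)
    with refls (t∈S (here refl))
  ... | refl with trans (sym rot) (cong proj₂ (sym prod≡z))
  ...   | ()
  no-short-word _ _ _ _ (suc (suc _)) (s≤s (s≤s ()))

  nontrivial-pair-length : AllReflections → ∀ {s s'} → s ∈ S → s' ∈ S →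
    prod (s ∷ s' ∷ []) ≢ one → WordLength S (prod (s ∷ s' ∷ [])) 2
  nontrivial-pair-length refls {s} {s'} s∈S s'∈S ≢1 =
      (s ∷ s' ∷ [] , refl , letters , refl)
    , no-short-word refls _ (rotation-parity s s' (refls s∈S) (refls s'∈S)) ≢1
    where
      letters : ∀ {x} → x ∈ s ∷ s' ∷ [] → x ∈ S
      letters (here refl)         = s∈S
      letters (there (here refl)) = s'∈S
      rotation-parity : ∀ s s' → IsReflection s → IsReflection s' → proj₂ (prod (s ∷ s' ∷ [])) ≡ false
      rotation-parity (_ , _) (_ , _) refl refl = refl

  -- z has length at most 2 (the shape of the first half of Lambda2 S 2).
  Length≤2 : D n → Set
  Length≤2 z = ∃[ k ] (k ≤ 2 × WordLength S z k)

  pair-length≤2 : AllReflections → ∀ {s s'} → s ∈ S → s' ∈ S → Length≤2 (prod (s ∷ s' ∷ []))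
  pair-length≤2 refls {s} {s'} s∈S s'∈S with ≡-dec _≟ᶠ_ _≟ᵇ_ (prod (s ∷ s' ∷ [])) one
  ... | yes ≡1 = 0 , z≤n , ([] , refl , (λ ()) , sym ≡1) , λ _ ()
  ... | no  ≢1 = 2 , ℕP.≤-refl , nontrivial-pair-length refls s∈S s'∈S ≢1

  lambda₂-of-reflections : AllReflections → ∀ {s₀ s₁} → s₀ ∈ S → s₁ ∈ S → s₀ ≢ s₁ → Lambda2 S 2
  lambda₂-of-reflections refls {s₀} {s₁} s₀∈S s₁∈S s₀≢s₁ = upper , (one , s₀ , s₁ , s₀∈S , s₁∈S , attained)
    where
      upper : ∀ g s s' → s ∈ S → s' ∈ S → Length≤2 (g · (s · (s' · inv g)))
      upper g s s' s∈S s'∈S with conjugate-pair g s s' (refls s∈S) (refls s'∈S)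
      ... | inj₁ eq = subst Length≤2 (sym eq) (pair-length≤2 refls s∈S s'∈S)
      ... | inj₂ eq = subst Length≤2 (sym eq) (pair-length≤2 refls s'∈S s∈S)
      attained : WordLength S (one · (s₀ · (s₁ · inv one))) 2
      attained = subst (λ z → WordLength S z 2)
        (sym (conjugate-by-rotation _ s₀ s₁ (refls s₀∈S) (refls s₁∈S)))
        (nontrivial-pair-length refls s₀∈S s₁∈S
          (λ ≡1 → s₀≢s₁ (trivial-pair⇒equal s₀ s₁ (refls s₀∈S) (refls s₁∈S) ≡1)))

theorem12 : (n : ℕ) .{{nz : NonZero n}} → n ≥ 3 → (a b : ℤ) →
    let open Dihedral n in
    f ≢ rpow a · f → f ≢ rpow b · f → rpow a · f ≢ rpow b · f →
    Generates (f ∷ rpow a · f ∷ rpow b · f ∷ []) →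
    Lambda2 (f ∷ rpow a · f ∷ rpow b · f ∷ []) 2
theorem12 n _ a b f≢raf _ _ _ =
  lambda₂-of-reflections all-reflections (here refl) (there (here refl)) f≢raf
  where
    open Dihedral n
    open ReflectionWords n (f ∷ rpow a · f ∷ rpow b · f ∷ [])
    all-reflections : AllReflections
    all-reflections (here refl)                 = refl
    all-reflections (there (here refl))         = refl
    all-reflections (there (there (here refl))) = refl
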